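{- Let $V$ be a finite vertex set and $\mathcal{E}_\ell$ a weight function on unordered pairs of distinct vertices with values in $[0,1]$ and total weight $1$. Let $S\subseteq V$ with $V\setminus S\neq\emptyset$, let $h:S\to\{0,1\}$ be an arbitrary partial assignment, let $\tau>0$, $\delta_0>0$, $\epsilon_0>0$, and let $g:V\setminus S\to\{0,1\}$ be a random assignment in which the values $g(v)$, $v\in V\setminus S$, are independent and each is $\tau$-smooth (i.e. $\Pr[g(v)=1]\ge\tau$ and $\Pr[g(v)=0]\ge\tau$). Define $$Y_\ell=\sum_{e\in\mathsf{Active}(S)}\mathcal{E}_\ell(e)\,e(h\cup g),\qquad \mathsf{Uvar}_\ell=\sum_{(e,e'):\,e\sim_S e'}\mathcal{E}_\ell(e)\mathcal{E}_\ell(e'),\qquad \mathsf{Lmean}_\ell=\tau\sum_{e\in\mathsf{Active}(S)}\mathcal{E}_\ell(e).$$ Then: (1) If $\mathsf{Uvar}_\ell\le\delta_0\epsilon_0^2\,\mathsf{Lmean}_\ell^2$, then $\Pr[Y_\ell<(1-\epsilon_0)\mathbb{E}[Y_\ell]]<\delta_0$. (2) If $\mathsf{Uvar}_\ell\ge\delta_0\epsilon_0^2\,\mathsf{Lmean}_\ell^2$, then there exists $v\in V\setminus S$ with $\mathsf{actdeg}_S(v,\ell)\ge\frac14\tau^2\epsilon_0^2\delta_0\cdot\mathsf{actdeg}_S(\ell)$.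
   Context: For an assignment $f$ (possibly the union $h\cup g$ of two partial assignments on complementary sets) and an edge $e=\{u,v\}$, $e(f)=1$ if $f(u)\ne f(v)$ and $0$ otherwise. An edge (unordered pair) $e$ is active with respect to $S$ if at least one endpoint is not in $S$; $\mathsf{Active}(S)$ is the set of such pairs. For pairs $e,e'$, $e\sim_S e'$ means $e$ and $e'$ share a vertex lying in $V\setminus S$ (in particular $e\sim_S e$ for every active $e$); the sum defining $\mathsf{Uvar}_\ell$ is over ordered pairs. Active degree: $\mathsf{actdeg}_S(v,\ell)=\sum_{e\in\mathsf{Active}(S),\,e\ni v}\mathcal{E}_\ell(e)$ for $v\in V\setminus S$, and $\mathsf{actdeg}_S(\ell)=\sum_{v\in V\setminus S}\mathsf{actdeg}_S(v,\ell)$.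
   Formalization: The weights $\mathcal{E}_\ell(e)$, the parameters τ, δ₀, ε₀ and the probabilities $\Pr[g(v)=1]$ are rational. -}

module Defs where

open import Data.Bool using (Bool; true; false; if_then_else_; not; _∧_; _∨_; _xor_)
open import Data.Nat using (ℕ; zero; suc)
open import Data.Fin using (Fin; zero; suc; _<?_; _≟_)
open import Data.Fin.Subset using (Subset)
open import Data.Vec using (Vec; []; _∷_; lookup)
open import Data.List using (List; []; _∷_; map; _++_; foldr)
open import Data.Rational using (ℚ; 0ℚ; 1ℚ; _+_; _*_; _-_; _<_)
open import Data.Rational.Properties using (_<?_)
open import Relation.Nullary using (does)

-- Vertex set V = Fin n.  S ⊆ V is a Subset n (true = inside S).
inS : ∀ {n} → Subset n → Fin n → Bool
inS S i = lookup S i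

sumFin : ∀ {n} → (Fin n → ℚ) → ℚ
sumFin {zero}  f = 0ℚ
sumFin {suc n} f = f zero + sumFin (λ i → f (suc i))

-- Sum over unordered pairs {i,j} of distinct vertices, each listed once as i < j.
sumPairs : ∀ {n} → (Fin n → Fin n → ℚ) → ℚ
sumPairs f = sumFin (λ i → sumFin (λ j → if does (i Data.Fin.<? j) then f i j else 0ℚ))

ind : Bool → ℚ
ind b = if b then 1ℚ else 0ℚ

active : ∀ {n} → Subset n → Fin n → Fin n → Bool
active S i j = not (inS S i ∧ inS S j)

cut : ∀ {n} → Vec Bool n → Fin n → Fin n → ℚ
cut f i j = ind (lookup f i xor lookup f j)

_==_ : ∀ {n} → Fin n → Fin n → Bool
i == j = does (i ≟ j)

-- e ∼_S e' : e = {i,j}, e' = {k,l} share a vertex lying outside S.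
related : ∀ {n} → Subset n → Fin n → Fin n → Fin n → Fin n → Bool
related S i j k l =
  (not (inS S i) ∧ (i == k ∨ i == l)) ∨ (not (inS S j) ∧ (j == k ∨ j == l))

-- Y_ℓ evaluated at the full assignment f = h ∪ g.
Y : ∀ {n} → (Fin n → Fin n → ℚ) → Subset n → Vec Bool n → ℚ
Y w S f = sumPairs (λ i j → ind (active S i j) * (w i j * cut f i j))

Uvar : ∀ {n} → (Fin n → Fin n → ℚ) → Subset n → ℚ
Uvar w S = sumPairs (λ i j → sumPairs (λ k l → ind (related S i j k l) * (w i j * w k l)))

Lmean : ∀ {n} → (Fin n → Fin n → ℚ) → Subset n → ℚ → ℚ
Lmean w S τ = τ * sumPairs (λ i j → ind (active S i j) * w i j)

actdeg : ∀ {n} → (Fin n → Fin n → ℚ) → Subset n → Fin n → ℚ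
actdeg w S v = sumPairs (λ i j → ind (active S i j ∧ (i == v ∨ j == v)) * w i j)

actdegTot : ∀ {n} → (Fin n → Fin n → ℚ) → Subset n → ℚ
actdegTot w S = sumFin (λ v → ind (not (inS S v)) * actdeg w S v)

allVecs : (n : ℕ) → List (Vec Bool n)
allVecs zero    = [] ∷ []
allVecs (suc n) = map (true ∷_) (allVecs n) ++ map (false ∷_) (allVecs n)

-- Probability that the random assignment h ∪ g equals f, where g(v) (v ∉ S)
-- are independent with Pr[g(v) = 1] = p v, and f agrees with h on S.
prodFin : ∀ {n} → (Fin n → ℚ) → ℚ
prodFin {zero}  f = 1ℚ
prodFin {suc n} f = f zero * prodFin (λ i → f (suc i))

beq : Bool → Bool → Bool
beq a b = not (a xor b)

prob : ∀ {n} → Subset n → Vec Bool n → (Fin n → ℚ) → Vec Bool n → ℚ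
prob S h p f = prodFin (λ v →
  if inS S v then ind (beq (lookup f v) (lookup h v))
  else (if lookup f v then p v else 1ℚ - p v))

Exp : ∀ {n} → Subset n → Vec Bool n → (Fin n → ℚ) → (Vec Bool n → ℚ) → ℚ
Exp {n} S h p X = foldr (λ f acc → prob S h p f * X f + acc) 0ℚ (allVecs n)

Pr : ∀ {n} → Subset n → Vec Bool n → (Fin n → ℚ) → (Vec Bool n → Bool) → ℚ
Pr S h p A = Exp S h p (λ f → ind (A f))

_<ᵇ_ : ℚ → ℚ → Bool
a <ᵇ b = does (a Data.Rational.Properties.<? b)

{-# OPTIONS --safe #-}
-- Write Y = Σₑ aₑ Xₑ, where aₑ = E_ℓ(e) for active e (0 otherwise) and Xₑ indicates that h ∪ g cuts e.
-- (1) An active edge has a free endpoint, whose τ-smooth value is independent of the other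
-- endpoint, so E[Xₑ] ≥ τ and E[Y] ≥ Lmean. Vertices of S are deterministic, so edges sharing no
-- free vertex have independent cut indicators, and indicators have covariance ≤ 1/4; hence
-- Var Y = Σ_{e,e′} aₑ aₑ′ Cov(Xₑ, Xₑ′) ≤ Uvar / 4, and Chebyshev bounds the lower tail by
-- Var Y / (ε₀ E[Y])² ≤ δ₀ / 4.
-- (2) Each pair e ∼ e′ shares a free vertex, so Uvar ≤ Σ_{v ∉ S} actdeg(v)² ≤ actdeg · max_v actdeg(v),
-- and actdeg ≤ 2 Lmean / τ because an edge has two endpoints. Together with δ₀ ε₀² Lmean² ≤ Uvar
-- this bounds the active degree of a vertex of maximal active degree from below.
module Submission where

open import Defs
open import Data.Bool using (Bool; true; false; if_then_else_; not; _∧_; _∨_; _xor_; T)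
open import Data.Bool.Properties using (T-∨; T-∧; T-≡; T-not-≡; ∧-zeroʳ; ∨-zeroʳ)
open import Data.Nat using (ℕ; zero; suc)
open import Data.Fin using (Fin; zero; suc; _<_)
open import Data.Fin.Properties using (<⇒≢)
open import Data.Fin.Subset using (Subset; _∉_)
open import Data.Vec using (Vec; []; _∷_; lookup; _[_]≔_)
open import Data.Vec.Properties using (lookup∘update′; []=⇒lookup; lookup⇒[]=)
open import Data.List using (List; []; _∷_; map; _++_; foldr; filter; allFin)
import Data.List.Relation.Unary.All as All
open import Data.List.Relation.Unary.All.Properties using (all-filter)
open import Data.List.Membership.Propositional.Properties using (∈-filter⁺; ∈-allFin)
open import Relation.Binary.Bundles using (DecTotalOrder)
open import Relation.Unary as U using ()
open import Data.Integer using (+_)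
open import Data.Product using (_×_; ∃-syntax; _,_; proj₁; proj₂; curry; uncurry)
open import Data.Sum using (_⊎_; inj₁; inj₂)
import Data.Sum as Sum
open import Data.Rational using (ℚ; 0ℚ; 1ℚ; ½; _≤_; _+_; _*_; _-_; -_; _/_)
import Data.Rational as ℚ
open import Data.Rational.Properties as ℚP using (+-*-commutativeRing)
open import Algebra.Bundles using (CommutativeRing)
open import Algebra.Properties.Semiring.Sum (CommutativeRing.semiring +-*-commutativeRing)
  using (sum; sum-cong-≗; ∑-distrib-+; *-distribˡ-sum)
open import Function using (_∘_; Equivalence)
open import Level using (0ℓ)
open import Relation.Nullary using (Dec; yes; no; does; ¬_)
open import Relation.Nullary.Decidable using (dec⇒maybe; dec-true; dec-false; _⊎-dec_; toWitness)
open import Relation.Nullary.Negation using (contradiction)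
open import Relation.Binary.PropositionalEquality
open import Tactic.RingSolver using (solve-∀)
import Tactic.RingSolver.Core.AlmostCommutativeRing as ACR
open import Data.List.Extrema (DecTotalOrder.totalOrder ℚP.≤-decTotalOrder) using (argmax; argmax-all; f[xs]≤f[argmax])

ℚ-ring : ACR.AlmostCommutativeRing 0ℓ 0ℓ
ℚ-ring = ACR.fromCommutativeRing +-*-commutativeRing (λ x → dec⇒maybe (0ℚ ℚP.≟ x))

private
  variable
    p q r : ℚ

0≤-* : 0ℚ ≤ p → 0ℚ ≤ q → 0ℚ ≤ p * q
0≤-* {p} {q} 0≤p 0≤q =
  ℚP.nonNegative⁻¹ (p * q) {{ℚP.nonNeg*nonNeg⇒nonNeg p {{ℚ.nonNegative 0≤p}} q {{ℚ.nonNegative 0≤q}}}}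

0≤p*p : ∀ p → 0ℚ ≤ p * p
0≤p*p p with ℚP.≤-total 0ℚ p
... | inj₁ 0≤p = 0≤-* 0≤p 0≤p
... | inj₂ p≤0 = ℚP.nonNegative⁻¹ (p * p) {{ℚP.nonPos*nonPos⇒nonPos p {{ℚ.nonPositive p≤0}} p {{ℚ.nonPositive p≤0}}}}

*-monoˡ-≤-0≤ : 0ℚ ≤ r → p ≤ q → r * p ≤ r * q
*-monoˡ-≤-0≤ {r} 0≤r = ℚP.*-monoˡ-≤-nonNeg r {{ℚ.nonNegative 0≤r}}

*-monoʳ-≤-0≤ : 0ℚ ≤ r → p ≤ q → p * r ≤ q * r
*-monoʳ-≤-0≤ {r} 0≤r = ℚP.*-monoʳ-≤-nonNeg r {{ℚ.nonNegative 0≤r}}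

square-mono-≤ : 0ℚ ≤ p → p ≤ q → p * p ≤ q * q
square-mono-≤ 0≤p p≤q = ℚP.≤-trans (*-monoˡ-≤-0≤ 0≤p p≤q) (*-monoʳ-≤-0≤ (ℚP.≤-trans 0≤p p≤q) p≤q)

p≤q⇒0≤q-p : p ≤ q → 0ℚ ≤ q - p
p≤q⇒0≤q-p {p} {q} p≤q = subst (_≤ q - p) (ℚP.+-inverseʳ p) (ℚP.+-monoˡ-≤ (- p) p≤q)

≤-from-gap : ∀ c → q - p ≡ c → 0ℚ ≤ c → p ≤ q
≤-from-gap {q} {p} c q-p≡c 0≤c =
  subst₂ _≤_ (ℚP.+-identityˡ p) (cancel p q) (ℚP.+-monoˡ-≤ p (subst (0ℚ ≤_) (sym q-p≡c) 0≤c))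
  where
  cancel : ∀ p q → q - p + p ≡ q
  cancel = solve-∀ ℚ-ring

¼ : ℚ
¼ = + 1 / 4

ind-0≤ : ∀ b → 0ℚ ≤ ind b
ind-0≤ true  = ℚP.nonNegative⁻¹ 1ℚ
ind-0≤ false = ℚP.≤-refl

ind-≤1 : ∀ b → ind b ≤ 1ℚ
ind-≤1 true  = ℚP.≤-refl
ind-≤1 false = ℚP.nonNegative⁻¹ 1ℚ

ind-xor : ∀ a b → ind (a xor b) ≡ ind a * (1ℚ - ind b) + (1ℚ - ind a) * ind b
ind-xor true  true  = refl
ind-xor true  false = refl
ind-xor false true  = refl
ind-xor false false = refl

ind-*-≤ : ∀ b {y} → 0ℚ ≤ y → ind b * y ≤ y
ind-*-≤ true  {y} _   = ℚP.≤-reflexive (ℚP.*-identityˡ y)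
ind-*-≤ false {y} 0≤y = subst (_≤ y) (sym (ℚP.*-zeroˡ y)) 0≤y

ind-∧∨-≤ : ∀ a b c → ind (a ∧ (b ∨ c)) ≤ ind a * (ind b + ind c)
ind-∧∨-≤ false b     c = ℚP.≤-reflexive (sym (ℚP.*-zeroˡ (ind b + ind c)))
ind-∧∨-≤ true  true  c = ≤-from-gap (ind c) (gap (ind c)) (ind-0≤ c)
  where
  gap : ∀ x → 1ℚ * (1ℚ + x) - 1ℚ ≡ x
  gap = solve-∀ ℚ-ring
ind-∧∨-≤ true  false c = ℚP.≤-reflexive (same (ind c))
  where
  same : ∀ x → x ≡ 1ℚ * (0ℚ + x)
  same = solve-∀ ℚ-ring

ind-event-≤ : ∀ {P : Set} (P? : Dec P) {k x} → 0ℚ ≤ x → (P → k ≤ x) → k * ind (does P?) ≤ x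
ind-event-≤ (yes p) {k} _   k≤x = subst (_≤ _) (sym (ℚP.*-identityʳ k)) (k≤x p)
ind-event-≤ (no _)  {k} 0≤x _   = subst (_≤ _) (sym (ℚP.*-zeroʳ k)) 0≤x

does⇒ : ∀ {P : Set} (P? : Dec P) → T (does P?) → P
does⇒ (yes p) _ = p

⇒does : ∀ {P : Set} (P? : Dec P) → P → T (does P?)
⇒does (yes _) _ = _
⇒does (no ¬p) p = ¬p p

==⇒≡ : ∀ {n} {u k : Fin n} → T (u == k) → u ≡ k
==⇒≡ {u = u} {k} = does⇒ (u Data.Fin.≟ k)

≡⇒== : ∀ {n} {u k : Fin n} → u ≡ k → T (u == k)
≡⇒== {u = u} {k} = ⇒does (u Data.Fin.≟ k)

finite-argmax : ∀ {n} (f : Fin n → ℚ) {P : Fin n → Set} → U.Decidable P →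
                ∀ {v₀} → P v₀ → ∃[ m ] P m × (∀ v → P v → f v ≤ f m)
finite-argmax {n} f P? {v₀} Pv₀ =
  argmax f v₀ xs , argmax-all f Pv₀ (all-filter P? (allFin n)) ,
  λ v Pv → All.lookup (f[xs]≤f[argmax] v₀ xs) (∈-filter⁺ P? (∈-allFin v) Pv)
  where
  xs : List (Fin n)
  xs = filter P? (allFin n)

sumFin≡sum : ∀ {n} (f : Fin n → ℚ) → sumFin f ≡ sum f
sumFin≡sum {zero}  f = refl
sumFin≡sum {suc n} f = cong (_+_ (f zero)) (sumFin≡sum (λ i → f (suc i)))

sumFin-cong : ∀ {n} {f g : Fin n → ℚ} → f ≗ g → sumFin f ≡ sumFin g
sumFin-cong {f = f} {g} f≗g = trans (sumFin≡sum f) (trans (sum-cong-≗ f≗g) (sym (sumFin≡sum g)))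

record Linear {A : Set} (Φ : (A → ℚ) → ℚ) : Set where
  field
    cong-≗  : ∀ {f g} → f ≗ g → Φ f ≡ Φ g
    +-homo  : ∀ f g → Φ (λ x → f x + g x) ≡ Φ f + Φ g
    *ˡ-homo : ∀ c f → Φ (λ x → c * f x) ≡ c * Φ f

  0-homo : Φ (λ _ → 0ℚ) ≡ 0ℚ
  0-homo = trans (*ˡ-homo 0ℚ (λ _ → 0ℚ)) (ℚP.*-zeroˡ (Φ (λ _ → 0ℚ)))

  *ʳ-homo : ∀ c f → Φ (λ x → f x * c) ≡ Φ f * c
  *ʳ-homo c f = trans (cong-≗ (λ x → ℚP.*-comm (f x) c)) (trans (*ˡ-homo c f) (ℚP.*-comm c (Φ f)))

  sub-homo : ∀ f g → Φ (λ x → f x - g x) ≡ Φ f - Φ g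
  sub-homo f g = begin
    Φ (λ x → f x - g x)             ≡⟨ cong-≗ (λ x → as-sum (f x) (g x)) ⟩
    Φ (λ x → f x + - 1ℚ * g x)      ≡⟨ +-homo f _ ⟩
    Φ f + Φ (λ x → - 1ℚ * g x)      ≡⟨ cong (_+_ (Φ f)) (*ˡ-homo (- 1ℚ) g) ⟩
    Φ f + - 1ℚ * Φ g                ≡⟨ as-sum (Φ f) (Φ g) ⟨
    Φ f - Φ g                       ∎
    where
    open ≡-Reasoning
    as-sum : ∀ x y → x - y ≡ x + - 1ℚ * y
    as-sum = solve-∀ ℚ-ring

  if-homo : ∀ b f → Φ (λ x → if b then f x else 0ℚ) ≡ (if b then Φ f else 0ℚ)
  if-homo true  f = refl
  if-homo false f = 0-homo

  sumFin-homo : ∀ {m} (F : Fin m → A → ℚ) → Φ (λ x → sumFin (λ i → F i x)) ≡ sumFin (λ i → Φ (F i))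
  sumFin-homo {zero}  F = 0-homo
  sumFin-homo {suc m} F =
    trans (+-homo (F zero) _) (cong (_+_ (Φ (F zero))) (sumFin-homo (λ i → F (suc i))))

  sumPairs-homo : ∀ {m} (F : Fin m → Fin m → A → ℚ) →
                  Φ (λ x → sumPairs (λ i j → F i j x)) ≡ sumPairs (λ i j → Φ (F i j))
  sumPairs-homo {m} F = trans (sumFin-homo {m} _) (sumFin-cong λ i →
    trans (sumFin-homo {m} _) (sumFin-cong λ j → if-homo _ (F i j)))

sumFin-linear : ∀ {n} → Linear (sumFin {n})
sumFin-linear = record
  { cong-≗  = sumFin-cong
  ; +-homo  = λ f g → trans (sumFin≡sum (λ i → f i + g i))
                             (trans (∑-distrib-+ f g) (sym (cong₂ _+_ (sumFin≡sum f) (sumFin≡sum g))))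
  ; *ˡ-homo = λ c f → trans (sumFin≡sum (λ i → c * f i))
                             (trans (sym (*-distribˡ-sum c f)) (cong (c *_) (sym (sumFin≡sum f))))
  }

module ΣF {n} = Linear (sumFin-linear {n})

sumFin-mono : ∀ {n} {f g : Fin n → ℚ} → (∀ i → f i ≤ g i) → sumFin f ≤ sumFin g
sumFin-mono {zero}  f≤g = ℚP.≤-refl
sumFin-mono {suc n} f≤g = ℚP.+-mono-≤ (f≤g zero) (sumFin-mono (f≤g ∘ suc))

sumFin-0≤ : ∀ {n} {f : Fin n → ℚ} → (∀ i → 0ℚ ≤ f i) → 0ℚ ≤ sumFin f
sumFin-0≤ {n} {f} 0≤f = subst (_≤ sumFin f) (ΣF.0-homo {n}) (sumFin-mono 0≤f)

term≤sumFin : ∀ {n} {f : Fin n → ℚ} → (∀ i → 0ℚ ≤ f i) → ∀ v → f v ≤ sumFin f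
term≤sumFin {suc n} {f} 0≤f zero =
  subst (_≤ sumFin f) (ℚP.+-identityʳ (f zero)) (ℚP.+-monoʳ-≤ (f zero) (sumFin-0≤ (0≤f ∘ suc)))
term≤sumFin {suc n} {f} 0≤f (suc v) =
  subst (_≤ sumFin f) (ℚP.+-identityˡ (f (suc v))) (ℚP.+-mono-≤ (0≤f zero) (term≤sumFin (0≤f ∘ suc) v))

sumFin-δ : ∀ {n} (i : Fin n) → sumFin (λ v → ind (i == v)) ≡ 1ℚ
sumFin-δ {suc n} zero    = cong (_+_ 1ℚ) (ΣF.0-homo {n})
sumFin-δ {suc n} (suc i) = trans (cong (_+_ 0ℚ) (sumFin-δ i)) (ℚP.+-identityˡ 1ℚ)

sumPairs-linear : ∀ {n} → Linear {Fin n × Fin n} (sumPairs ∘ curry)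
sumPairs-linear {n} = record
  { cong-≗  = λ f≗g → sumFin-cong λ i → sumFin-cong λ j →
                 cong (λ x → if does (i Data.Fin.<? j) then x else 0ℚ) (f≗g (i , j))
  ; +-homo  = λ f g → trans (sumFin-cong λ i → trans (sumFin-cong λ j → if-+ _ (f (i , j)) (g (i , j)))
                                                     (ΣF.+-homo {n} _ _))
                            (ΣF.+-homo {n} _ _)
  ; *ˡ-homo = λ c f → trans (sumFin-cong λ i → trans (sumFin-cong λ j → if-* _ c (f (i , j)))
                                                     (ΣF.*ˡ-homo {n} c _))
                            (ΣF.*ˡ-homo {n} c _)
  }
  where
  if-+ : ∀ b x y → (if b then x + y else 0ℚ) ≡ (if b then x else 0ℚ) + (if b then y else 0ℚ)
  if-+ true  x y = refl
  if-+ false x y = refl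
  if-* : ∀ b c x → (if b then c * x else 0ℚ) ≡ c * (if b then x else 0ℚ)
  if-* true  c x = refl
  if-* false c x = sym (ℚP.*-zeroʳ c)

module ΣP {n} = Linear (sumPairs-linear {n})

sumPairs-mono : ∀ {n} {f g : Fin n → Fin n → ℚ} → (∀ i j → i < j → f i j ≤ g i j) → sumPairs f ≤ sumPairs g
sumPairs-mono f≤g = sumFin-mono λ i → sumFin-mono λ j → guarded (i Data.Fin.<? j) (f≤g i j)
  where
  guarded : ∀ {P : Set} (P? : Dec P) {x y} → (P → x ≤ y) → (if does P? then x else 0ℚ) ≤ (if does P? then y else 0ℚ)
  guarded (yes p) x≤y = x≤y p
  guarded (no _)  _   = ℚP.≤-refl

sumPairs-0≤ : ∀ {n} {f : Fin n → Fin n → ℚ} → (∀ i j → i < j → 0ℚ ≤ f i j) → 0ℚ ≤ sumPairs f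
sumPairs-0≤ {n} {f} 0≤f = subst (_≤ sumPairs f) (ΣP.0-homo {n}) (sumPairs-mono 0≤f)

sumPairs-* : ∀ {n} (f g : Fin n → Fin n → ℚ) →
             sumPairs f * sumPairs g ≡ sumPairs (λ i j → sumPairs (λ k l → f i j * g k l))
sumPairs-* f g = trans (sym (ΣP.*ʳ-homo (sumPairs g) (uncurry f)))
                       (ΣP.cong-≗ λ (i , j) → sym (ΣP.*ˡ-homo (f i j) (uncurry g)))

wsum : ∀ {A : Set} → (A → ℚ) → List A → (A → ℚ) → ℚ
wsum q xs X = foldr (λ x acc → q x * X x + acc) 0ℚ xs

wsum-linear : ∀ {A : Set} (q : A → ℚ) xs → Linear (wsum q xs)
wsum-linear q xs = record { cong-≗ = go-cong xs ; +-homo = go-+ xs ; *ˡ-homo = go-* xs }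
  where
  go-cong : ∀ xs {X Y} → X ≗ Y → wsum q xs X ≡ wsum q xs Y
  go-cong []       _   = refl
  go-cong (x ∷ xs) X≗Y = cong₂ (λ a b → q x * a + b) (X≗Y x) (go-cong xs X≗Y)
  go-+ : ∀ xs X Y → wsum q xs (λ x → X x + Y x) ≡ wsum q xs X + wsum q xs Y
  go-+ []       X Y = refl
  go-+ (x ∷ xs) X Y = trans (cong (_+_ (q x * (X x + Y x))) (go-+ xs X Y)) (shuffle (q x) (X x) (Y x) _ _)
    where
    shuffle : ∀ a b c d e → a * (b + c) + (d + e) ≡ a * b + d + (a * c + e)
    shuffle = solve-∀ ℚ-ring
  go-* : ∀ xs c X → wsum q xs (λ x → c * X x) ≡ c * wsum q xs X
  go-* []       c X = sym (ℚP.*-zeroʳ c)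
  go-* (x ∷ xs) c X = trans (cong (_+_ (q x * (c * X x))) (go-* xs c X)) (factor (q x) c (X x) _)
    where
    factor : ∀ a c b e → a * (c * b) + c * e ≡ c * (a * b + e)
    factor = solve-∀ ℚ-ring

wsum-++ : ∀ {A : Set} (q : A → ℚ) xs ys X → wsum q (xs ++ ys) X ≡ wsum q xs X + wsum q ys X
wsum-++ q []       ys X = sym (ℚP.+-identityˡ _)
wsum-++ q (x ∷ xs) ys X =
  trans (cong (_+_ (q x * X x)) (wsum-++ q xs ys X)) (sym (ℚP.+-assoc (q x * X x) _ _))

wsum-map : ∀ {A B : Set} (q : B → ℚ) (g : A → B) xs X → wsum q (map g xs) X ≡ wsum (q ∘ g) xs (X ∘ g)
wsum-map q g []       X = refl
wsum-map q g (x ∷ xs) X = cong (_+_ (q (g x) * X (g x))) (wsum-map q g xs X)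

wsum-scale : ∀ {A : Set} c (q : A → ℚ) xs X → wsum (λ x → c * q x) xs X ≡ c * wsum q xs X
wsum-scale c q []       X = sym (ℚP.*-zeroʳ c)
wsum-scale c q (x ∷ xs) X = trans (cong (_+_ (c * q x * X x)) (wsum-scale c q xs X)) (factor c (q x) (X x) _)
  where
  factor : ∀ c a b e → c * a * b + c * e ≡ c * (a * b + e)
  factor = solve-∀ ℚ-ring

Exp-linear : ∀ {n} (S : Subset n) h p → Linear (Exp S h p)
Exp-linear {n} S h p = wsum-linear (prob S h p) (allVecs n)

mix : ℚ → ℚ → ℚ → ℚ
mix π x y = π * x + (1ℚ - π) * y

mix-same : ∀ π x → mix π x x ≡ x
mix-same = same
  where
  same : ∀ π x → π * x + (1ℚ - π) * x ≡ x
  same = solve-∀ ℚ-ring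

mix-* : ∀ π {x₁ x₀ y₁ y₀} → x₁ ≡ x₀ ⊎ y₁ ≡ y₀ →
        mix π (x₁ * y₁) (x₀ * y₀) ≡ mix π x₁ x₀ * mix π y₁ y₀
mix-* π {x} {_} {y₁} {y₀} (inj₁ refl) = factor π x y₁ y₀
  where
  factor : ∀ π x y₁ y₀ → π * (x * y₁) + (1ℚ - π) * (x * y₀) ≡ (π * x + (1ℚ - π) * x) * (π * y₁ + (1ℚ - π) * y₀)
  factor = solve-∀ ℚ-ring
mix-* π {x₁} {x₀} {y} (inj₂ refl) = factor π x₁ x₀ y
  where
  factor : ∀ π x₁ x₀ y → π * (x₁ * y) + (1ℚ - π) * (x₀ * y) ≡ (π * x₁ + (1ℚ - π) * x₀) * (π * y + (1ℚ - π) * y)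
  factor = solve-∀ ℚ-ring

mix-mono-≤ : ∀ {π x x′ y y′} → 0ℚ ≤ π → 0ℚ ≤ 1ℚ - π → x ≤ x′ → y ≤ y′ → mix π x y ≤ mix π x′ y′
mix-mono-≤ 0≤π 0≤1-π x≤x′ y≤y′ = ℚP.+-mono-≤ (*-monoˡ-≤-0≤ 0≤π x≤x′) (*-monoˡ-≤-0≤ 0≤1-π y≤y′)

coordWeight : Bool → Bool → ℚ → Bool → ℚ
coordWeight s b π t = if s then ind (beq t b) else (if t then π else 1ℚ - π)

Exp-∷ : ∀ {n} s (S : Subset n) b h p X →
        Exp (s ∷ S) (b ∷ h) p X ≡ coordWeight s b (p zero) true  * Exp S h (p ∘ suc) (X ∘ (true ∷_))
                                + coordWeight s b (p zero) false * Exp S h (p ∘ suc) (X ∘ (false ∷_))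
Exp-∷ {n} s S b h p X = begin
  wsum ρ (map (true ∷_) L ++ map (false ∷_) L) X
    ≡⟨ wsum-++ ρ (map (true ∷_) L) _ X ⟩
  wsum ρ (map (true ∷_) L) X + wsum ρ (map (false ∷_) L) X
    ≡⟨ cong₂ _+_ (branch true) (branch false) ⟩
  _ ∎
  where
  open ≡-Reasoning
  ρ : Vec Bool (suc n) → ℚ
  ρ = prob (s ∷ S) (b ∷ h) p
  L : List (Vec Bool n)
  L = allVecs n
  branch : ∀ t → wsum ρ (map (t ∷_) L) X ≡ coordWeight s b (p zero) t * Exp S h (p ∘ suc) (X ∘ (t ∷_))
  branch t = trans (wsum-map ρ (t ∷_) L X) (wsum-scale (coordWeight s b (p zero) t) (prob S h (p ∘ suc)) L (X ∘ (t ∷_)))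

Exp-fixed-∷ : ∀ {n} (S : Subset n) b h p X → Exp (true ∷ S) (b ∷ h) p X ≡ Exp S h (p ∘ suc) (X ∘ (b ∷_))
Exp-fixed-∷ S true  h p X = trans (Exp-∷ true S true h p X) (keep-first _ (Exp S h (p ∘ suc) (X ∘ (false ∷_))))
  where
  keep-first : ∀ x y → 1ℚ * x + 0ℚ * y ≡ x
  keep-first = solve-∀ ℚ-ring
Exp-fixed-∷ S false h p X = trans (Exp-∷ true S false h p X) (keep-second (Exp S h (p ∘ suc) (X ∘ (true ∷_))) _)
  where
  keep-second : ∀ x y → 0ℚ * x + 1ℚ * y ≡ y
  keep-second = solve-∀ ℚ-ring

Exp-free-∷ : ∀ {n} (S : Subset n) b h p X →
             Exp (false ∷ S) (b ∷ h) p X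
               ≡ mix (p zero) (Exp S h (p ∘ suc) (X ∘ (true ∷_))) (Exp S h (p ∘ suc) (X ∘ (false ∷_)))
Exp-free-∷ S b h p X = Exp-∷ false S b h p X

Probabilities : ∀ {n} → Subset n → (Fin n → ℚ) → Set
Probabilities S p = ∀ v → inS S v ≡ false → 0ℚ ≤ p v × 0ℚ ≤ 1ℚ - p v

Exp-const : ∀ {n} (S : Subset n) h p c → Exp S h p (λ _ → c) ≡ c
Exp-const []          []      p c = 1*c+0≡c c
  where
  1*c+0≡c : ∀ c → 1ℚ * c + 0ℚ ≡ c
  1*c+0≡c = solve-∀ ℚ-ring
Exp-const (true ∷ S)  (b ∷ h) p c = trans (Exp-fixed-∷ S b h p _) (Exp-const S h (p ∘ suc) c)
Exp-const (false ∷ S) (b ∷ h) p c = begin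
  Exp (false ∷ S) (b ∷ h) p (λ _ → c)  ≡⟨ Exp-free-∷ S b h p _ ⟩
  mix (p zero) (Exp S h (p ∘ suc) (λ _ → c)) (Exp S h (p ∘ suc) (λ _ → c))
    ≡⟨ cong₂ (mix (p zero)) (Exp-const S h (p ∘ suc) c) (Exp-const S h (p ∘ suc) c) ⟩
  mix (p zero) c c                     ≡⟨ mix-same (p zero) c ⟩
  c                                    ∎
  where open ≡-Reasoning

Exp-mono : ∀ {n} (S : Subset n) h p → Probabilities S p →
           ∀ {X Y} → (∀ f → X f ≤ Y f) → Exp S h p X ≤ Exp S h p Y
Exp-mono []          []      p _  X≤Y = ℚP.+-monoˡ-≤ 0ℚ (*-monoˡ-≤-0≤ (ind-0≤ true) (X≤Y []))
Exp-mono (true ∷ S)  (b ∷ h) p pr {X} {Y} X≤Y = begin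
  Exp (true ∷ S) (b ∷ h) p X     ≡⟨ Exp-fixed-∷ S b h p X ⟩
  Exp S h (p ∘ suc) (X ∘ (b ∷_)) ≤⟨ Exp-mono S h (p ∘ suc) (pr ∘ suc) (X≤Y ∘ (b ∷_)) ⟩
  Exp S h (p ∘ suc) (Y ∘ (b ∷_)) ≡⟨ Exp-fixed-∷ S b h p Y ⟨
  Exp (true ∷ S) (b ∷ h) p Y     ∎
  where open ℚP.≤-Reasoning
Exp-mono (false ∷ S) (b ∷ h) p pr {X} {Y} X≤Y = begin
  Exp (false ∷ S) (b ∷ h) p X  ≡⟨ Exp-free-∷ S b h p X ⟩
  mix (p zero) _ _             ≤⟨ mix-mono-≤ (proj₁ (pr zero refl)) (proj₂ (pr zero refl)) (tail true) (tail false) ⟩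
  mix (p zero) _ _             ≡⟨ Exp-free-∷ S b h p Y ⟨
  Exp (false ∷ S) (b ∷ h) p Y  ∎
  where
  open ℚP.≤-Reasoning
  tail : ∀ t → Exp S h (p ∘ suc) (X ∘ (t ∷_)) ≤ Exp S h (p ∘ suc) (Y ∘ (t ∷_))
  tail t = Exp-mono S h (p ∘ suc) (pr ∘ suc) (X≤Y ∘ (t ∷_))

Exp-ind-bounds : ∀ {n} (S : Subset n) h p → Probabilities S p →
                 ∀ (A : Vec Bool n → Bool) → 0ℚ ≤ Exp S h p (ind ∘ A) × Exp S h p (ind ∘ A) ≤ 1ℚ
Exp-ind-bounds S h p pr A =
  subst (_≤ Exp S h p (ind ∘ A)) (Exp-const S h p 0ℚ) (Exp-mono S h p pr (ind-0≤ ∘ A)) ,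
  subst (Exp S h p (ind ∘ A) ≤_) (Exp-const S h p 1ℚ) (Exp-mono S h p pr (ind-≤1 ∘ A))

Exp-coord : ∀ {n} (S : Subset n) h p v → inS S v ≡ false → Exp S h p (λ f → ind (lookup f v)) ≡ p v
Exp-coord (true ∷ S)  (b ∷ h) p zero    ()
Exp-coord (false ∷ S) (b ∷ h) p zero    _    =
  trans (Exp-free-∷ S b h p _)
        (trans (cong₂ (mix (p zero)) (Exp-const S h (p ∘ suc) 1ℚ) (Exp-const S h (p ∘ suc) 0ℚ)) (mix-1-0 (p zero)))
  where
  mix-1-0 : ∀ π → π * 1ℚ + (1ℚ - π) * 0ℚ ≡ π
  mix-1-0 = solve-∀ ℚ-ring
Exp-coord (true ∷ S)  (b ∷ h) p (suc v) free =
  trans (Exp-fixed-∷ S b h p _) (Exp-coord S h (p ∘ suc) v free)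
Exp-coord (false ∷ S) (b ∷ h) p (suc v) free =
  trans (Exp-free-∷ S b h p _)
        (trans (cong₂ (mix (p zero)) (Exp-coord S h (p ∘ suc) v free) (Exp-coord S h (p ∘ suc) v free)) (mix-same (p zero) _))

Ignores : ∀ {n} → (Vec Bool n → ℚ) → Fin n → Set
Ignores X v = ∀ f b → X (f [ v ]≔ b) ≡ X f

Ignores-∷ : ∀ {n} {X : Vec Bool (suc n) → ℚ} {v} t → Ignores X (suc v) → Ignores (X ∘ (t ∷_)) v
Ignores-∷ t ig f = ig (t ∷ f)

separated-∷ : ∀ {n} {s} {S : Subset n} {X Y : Vec Bool (suc n) → ℚ} →
              (∀ v → inS (s ∷ S) v ≡ false → Ignores X v ⊎ Ignores Y v) →
              ∀ t v → inS S v ≡ false → Ignores (X ∘ (t ∷_)) v ⊎ Ignores (Y ∘ (t ∷_)) v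
separated-∷ sep t v free = Sum.map (Ignores-∷ t) (Ignores-∷ t) (sep (suc v) free)

Exp-*-indep : ∀ {n} (S : Subset n) h p (X Y : Vec Bool n → ℚ) →
              (∀ v → inS S v ≡ false → Ignores X v ⊎ Ignores Y v) →
              Exp S h p (λ f → X f * Y f) ≡ Exp S h p X * Exp S h p Y
Exp-*-indep []          []      p X Y _   = base (X []) (Y [])
  where
  base : ∀ x y → 1ℚ * (x * y) + 0ℚ ≡ (1ℚ * x + 0ℚ) * (1ℚ * y + 0ℚ)
  base = solve-∀ ℚ-ring
Exp-*-indep (true ∷ S)  (b ∷ h) p X Y sep = begin
  Exp (true ∷ S) (b ∷ h) p (λ f → X f * Y f)               ≡⟨ Exp-fixed-∷ S b h p _ ⟩
  Exp S h (p ∘ suc) (λ f → X (b ∷ f) * Y (b ∷ f))          ≡⟨ Exp-*-indep S h (p ∘ suc) _ _ (separated-∷ sep b) ⟩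
  Exp S h (p ∘ suc) (X ∘ (b ∷_)) * Exp S h (p ∘ suc) (Y ∘ (b ∷_))
    ≡⟨ cong₂ _*_ (Exp-fixed-∷ S b h p X) (Exp-fixed-∷ S b h p Y) ⟨
  Exp (true ∷ S) (b ∷ h) p X * Exp (true ∷ S) (b ∷ h) p Y  ∎
  where open ≡-Reasoning
Exp-*-indep {suc n} (false ∷ S) (b ∷ h) p X Y sep = begin
  Exp (false ∷ S) (b ∷ h) p (λ f → X f * Y f)         ≡⟨ Exp-free-∷ S b h p _ ⟩
  mix (p zero) (E′ (λ f → X (true ∷ f) * Y (true ∷ f))) (E′ (λ f → X (false ∷ f) * Y (false ∷ f)))
    ≡⟨ cong₂ (mix (p zero)) (Exp-*-indep S h (p ∘ suc) _ _ (separated-∷ sep true))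
                            (Exp-*-indep S h (p ∘ suc) _ _ (separated-∷ sep false)) ⟩
  mix (p zero) (E′ (X ∘ (true ∷_)) * E′ (Y ∘ (true ∷_))) (E′ (X ∘ (false ∷_)) * E′ (Y ∘ (false ∷_)))
    ≡⟨ mix-* (p zero) (Sum.map first-irrelevant first-irrelevant (sep zero refl)) ⟩
  mix (p zero) (E′ (X ∘ (true ∷_))) (E′ (X ∘ (false ∷_))) * mix (p zero) (E′ (Y ∘ (true ∷_))) (E′ (Y ∘ (false ∷_)))
    ≡⟨ cong₂ _*_ (Exp-free-∷ S b h p X) (Exp-free-∷ S b h p Y) ⟨
  Exp (false ∷ S) (b ∷ h) p X * Exp (false ∷ S) (b ∷ h) p Y  ∎
  where
  open ≡-Reasoning
  E′ : (Vec Bool n → ℚ) → ℚ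
  E′ = Exp S h (p ∘ suc)
  first-irrelevant : ∀ {Z} → Ignores Z zero → E′ (Z ∘ (true ∷_)) ≡ E′ (Z ∘ (false ∷_))
  first-irrelevant ig = Linear.cong-≗ (Exp-linear S h (p ∘ suc)) (λ f → sym (ig (true ∷ f) false))

module Moments {n} (S : Subset n) (h : Vec Bool n) (p : Fin n → ℚ) where

  open Linear (Exp-linear S h p) public

  E : (Vec Bool n → ℚ) → ℚ
  E = Exp S h p

  Cov : (Vec Bool n → ℚ) → (Vec Bool n → ℚ) → ℚ
  Cov X Y = E (λ f → (X f - E X) * (Y f - E Y))

  Var : (Vec Bool n → ℚ) → ℚ
  Var X = Cov X X

  Var-cong : ∀ {X Y} → X ≗ Y → Var X ≡ Var Y
  Var-cong X≗Y = cong-≗ λ f → cong₂ (λ u v → (u - v) * (u - v)) (X≗Y f) (cong-≗ X≗Y)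

  E-centred : ∀ X → E (λ f → X f - E X) ≡ 0ℚ
  E-centred X = trans (sub-homo X (λ _ → E X)) (trans (cong (_-_ (E X)) (Exp-const S h p (E X))) (ℚP.+-inverseʳ (E X)))

  Cov-indep : ∀ X Y → (∀ v → inS S v ≡ false → Ignores X v ⊎ Ignores Y v) → Cov X Y ≡ 0ℚ
  Cov-indep X Y sep = begin
    Cov X Y                                               ≡⟨ Exp-*-indep S h p _ _ centred-sep ⟩
    E (λ f → X f - E X) * E (λ f → Y f - E Y)             ≡⟨ cong (_* E (λ f → Y f - E Y)) (E-centred X) ⟩
    0ℚ * E (λ f → Y f - E Y)                              ≡⟨ ℚP.*-zeroˡ (E (λ f → Y f - E Y)) ⟩
    0ℚ                                                    ∎
    where
    open ≡-Reasoning
    centring : ∀ {Z v} c → Ignores Z v → Ignores (λ f → Z f - c) v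
    centring c ig f b = cong (_- c) (ig f b)
    centred-sep : ∀ v → inS S v ≡ false → Ignores (λ f → X f - E X) v ⊎ Ignores (λ f → Y f - E Y) v
    centred-sep v free = Sum.map (centring (E X)) (centring (E Y)) (sep v free)

  Var-ind : ∀ (A : Vec Bool n → Bool) → Var (ind ∘ A) ≡ E (ind ∘ A) - E (ind ∘ A) * E (ind ∘ A)
  Var-ind A = begin
    Var (ind ∘ A)                                         ≡⟨ cong-≗ (λ f → square-centred (A f) m) ⟩
    E (λ f → (1ℚ - (m + m)) * ind (A f) + m * m)          ≡⟨ +-homo _ _ ⟩
    E (λ f → (1ℚ - (m + m)) * ind (A f)) + E (λ _ → m * m)
                                                          ≡⟨ cong₂ _+_ (*ˡ-homo (1ℚ - (m + m)) (ind ∘ A)) (Exp-const S h p (m * m)) ⟩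
    (1ℚ - (m + m)) * m + m * m                            ≡⟨ simplify m ⟩
    m - m * m                                             ∎
    where
    open ≡-Reasoning
    m : ℚ
    m = E (ind ∘ A)
    square-centred : ∀ b m → (ind b - m) * (ind b - m) ≡ (1ℚ - (m + m)) * ind b + m * m
    square-centred true  = solve-∀ ℚ-ring
    square-centred false = solve-∀ ℚ-ring
    simplify : ∀ m → (1ℚ - (m + m)) * m + m * m ≡ m - m * m
    simplify = solve-∀ ℚ-ring

  Var-ind-≤-¼ : ∀ (A : Vec Bool n → Bool) → Var (ind ∘ A) ≤ ¼
  Var-ind-≤-¼ A = subst (_≤ ¼) (sym (Var-ind A))
                        (≤-from-gap _ (gap m) (0≤-* (ℚP.nonNegative⁻¹ ¼) (0≤p*p (1ℚ - (m + m)))))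
    where
    m : ℚ
    m = E (ind ∘ A)
    gap : ∀ m → ¼ - (m - m * m) ≡ ¼ * ((1ℚ - (m + m)) * (1ℚ - (m + m)))
    gap = solve-∀ ℚ-ring

  Cov-≤-Var : Probabilities S p → ∀ X Y → Cov X Y ≤ ½ * Var X + ½ * Var Y
  Cov-≤-Var pr X Y = begin
    Cov X Y                                        ≤⟨ Exp-mono S h p pr (λ f → am-gm (X f - E X) (Y f - E Y)) ⟩
    E (λ f → ½ * ((X f - E X) * (X f - E X)) + ½ * ((Y f - E Y) * (Y f - E Y)))
                                                   ≡⟨ +-homo _ _ ⟩
    _                                              ≡⟨ cong₂ _+_ (*ˡ-homo ½ _) (*ˡ-homo ½ _) ⟩
    ½ * Var X + ½ * Var Y                          ∎
    where
    open ℚP.≤-Reasoning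
    am-gm : ∀ x y → x * y ≤ ½ * (x * x) + ½ * (y * y)
    am-gm x y = ≤-from-gap _ (gap x y) (0≤-* (ℚP.nonNegative⁻¹ ½) (0≤p*p (x - y)))
      where
      gap : ∀ x y → ½ * (x * x) + ½ * (y * y) - x * y ≡ ½ * ((x - y) * (x - y))
      gap = solve-∀ ℚ-ring

  Cov-ind-≤-¼ : Probabilities S p → ∀ (A B : Vec Bool n → Bool) → Cov (ind ∘ A) (ind ∘ B) ≤ ¼
  Cov-ind-≤-¼ pr A B = begin
    Cov (ind ∘ A) (ind ∘ B)               ≤⟨ Cov-≤-Var pr (ind ∘ A) (ind ∘ B) ⟩
    ½ * Var (ind ∘ A) + ½ * Var (ind ∘ B) ≤⟨ ℚP.+-mono-≤ (half (Var-ind-≤-¼ A)) (half (Var-ind-≤-¼ B)) ⟩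
    ½ * ¼ + ½ * ¼                         ≡⟨⟩
    ¼                                     ∎
    where
    open ℚP.≤-Reasoning
    half : ∀ {x y} → x ≤ y → ½ * x ≤ ½ * y
    half = *-monoˡ-≤-0≤ (ℚP.nonNegative⁻¹ ½)

  Var-sumPairs : ∀ {m} (a : Fin m → Fin m → ℚ) (X : Fin m → Fin m → Vec Bool n → ℚ) →
                 Var (λ f → sumPairs (λ i j → a i j * X i j f))
                   ≡ sumPairs (λ i j → sumPairs (λ k l → a i j * a k l * Cov (X i j) (X k l)))
  Var-sumPairs {m} a X = begin
    E (λ f → (Σ f - E Σ) * (Σ f - E Σ))
      ≡⟨ cong-≗ (λ f → cong (λ z → z * z) (centred f)) ⟩
    E (λ f → sumPairs (λ i j → a i j * X̃ i j f) * sumPairs (λ i j → a i j * X̃ i j f))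
      ≡⟨ cong-≗ (λ f → sumPairs-* (λ i j → a i j * X̃ i j f) (λ i j → a i j * X̃ i j f)) ⟩
    E (λ f → sumPairs (λ i j → sumPairs (λ k l → a i j * X̃ i j f * (a k l * X̃ k l f))))
      ≡⟨ sumPairs-homo {m} _ ⟩
    sumPairs (λ i j → E (λ f → sumPairs (λ k l → a i j * X̃ i j f * (a k l * X̃ k l f))))
      ≡⟨ ΣP.cong-≗ {m} (λ (i , j) → trans (sumPairs-homo {m} _) (ΣP.cong-≗ {m} λ (k , l) →
           trans (cong-≗ (λ f → regroup (a i j) (a k l) (X̃ i j f) (X̃ k l f))) (*ˡ-homo (a i j * a k l) _))) ⟩
    sumPairs (λ i j → sumPairs (λ k l → a i j * a k l * Cov (X i j) (X k l)))
      ∎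
    where
    open ≡-Reasoning
    Σ : Vec Bool n → ℚ
    Σ f = sumPairs (λ i j → a i j * X i j f)
    X̃ : Fin m → Fin m → Vec Bool n → ℚ
    X̃ i j f = X i j f - E (X i j)
    mean : E Σ ≡ sumPairs (λ i j → a i j * E (X i j))
    mean = trans (sumPairs-homo {m} _) (ΣP.cong-≗ {m} λ (i , j) → *ˡ-homo (a i j) (X i j))
    distrib : ∀ a x y → a * x - a * y ≡ a * (x - y)
    distrib = solve-∀ ℚ-ring
    centred : ∀ f → Σ f - E Σ ≡ sumPairs (λ i j → a i j * X̃ i j f)
    centred f = trans (cong (_-_ (Σ f)) mean)
                      (trans (sym (ΣP.sub-homo {m} _ _)) (ΣP.cong-≗ {m} λ (i , j) → distrib (a i j) _ _))
    regroup : ∀ a b x y → a * x * (b * y) ≡ a * b * (x * y)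
    regroup = solve-∀ ℚ-ring

  Chebyshev-lower : Probabilities S p → ∀ (Y : Vec Bool n → ℚ) ε → 0ℚ ≤ ε → 0ℚ ≤ E Y →
                    (ε * E Y) * (ε * E Y) * Pr S h p (λ f → Y f <ᵇ ((1ℚ - ε) * E Y)) ≤ Var Y
  Chebyshev-lower pr Y ε 0≤ε 0≤EY = begin
    K * E (λ f → ind (Y f <ᵇ ((1ℚ - ε) * E Y)))  ≡⟨ *ˡ-homo K _ ⟨
    E (λ f → K * ind (Y f <ᵇ ((1ℚ - ε) * E Y)))  ≤⟨ Exp-mono S h p pr (λ f →
                                                     ind-event-≤ (Y f ℚP.<? (1ℚ - ε) * E Y) (0≤p*p (Y f - E Y)) (far (Y f))) ⟩
    Var Y                                         ∎
    where
    open ℚP.≤-Reasoning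
    K : ℚ
    K = (ε * E Y) * (ε * E Y)
    gap : ∀ y m ε → m - y - ε * m ≡ (1ℚ - ε) * m - y
    gap = solve-∀ ℚ-ring
    flip : ∀ y m → (m - y) * (m - y) ≡ (y - m) * (y - m)
    flip = solve-∀ ℚ-ring
    far : ∀ y → y ℚ.< (1ℚ - ε) * E Y → K ≤ (y - E Y) * (y - E Y)
    far y y<c = subst (K ≤_) (flip y (E Y)) (square-mono-≤ {q = E Y - y} (0≤-* 0≤ε 0≤EY)
      (≤-from-gap ((1ℚ - ε) * E Y - y) (gap y (E Y) ε) (p≤q⇒0≤q-p (ℚP.<⇒≤ y<c))))

Endpoint : ∀ {n} → Fin n → Fin n → Fin n → Set
Endpoint v i j = i ≡ v ⊎ j ≡ v

endpoint? : ∀ {n} (v i j : Fin n) → Dec (Endpoint v i j)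
endpoint? v i j = (i Data.Fin.≟ v) ⊎-dec (j Data.Fin.≟ v)

free⇒∉ : ∀ {n} {S : Subset n} {v} → inS S v ≡ false → v ∉ S
free⇒∉ free v∈S = contradiction (trans (sym ([]=⇒lookup v∈S)) free) λ ()

∉⇒free : ∀ {n} {S : Subset n} {v} → v ∉ S → inS S v ≡ false
∉⇒free {S = S} {v} v∉S with inS S v in eq
... | true  = contradiction (lookup⇒[]= v S eq) v∉S
... | false = refl

module _ {n} (S : Subset n) where

  active⇒free-endpoint : ∀ i j → active S i j ≡ true → inS S i ≡ false ⊎ inS S j ≡ false
  active⇒free-endpoint i j act with inS S i | inS S j
  ... | false | _     = inj₁ refl
  ... | true  | false = inj₂ refl
  active⇒free-endpoint i j () | true | true

  free-endpoint⇒incident : ∀ {v i j} → inS S v ≡ false → Endpoint v i j → (active S i j ∧ (i == v ∨ j == v)) ≡ true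
  free-endpoint⇒incident {v} free (inj₁ refl) rewrite free | dec-true (v Data.Fin.≟ v) refl = refl
  free-endpoint⇒incident {v} {i} free (inj₂ refl)
    rewrite free | ∧-zeroʳ (inS S i) | dec-true (v Data.Fin.≟ v) refl | ∨-zeroʳ (i == v) = refl

  private
    shares : Fin n → Fin n → Fin n → Bool
    shares u k l = not (inS S u) ∧ (u == k ∨ u == l)

    shares⇒ : ∀ {u k l} → T (shares u k l) → inS S u ≡ false × Endpoint u k l
    shares⇒ {u} {k} {l} t with Equivalence.to (T-∧ {not (inS S u)}) t
    ... | t₁ , t₂ = Equivalence.to T-not-≡ t₁ , Sum.map (sym ∘ ==⇒≡) (sym ∘ ==⇒≡) (Equivalence.to (T-∨ {u == k}) t₂)

    ⇒shares : ∀ {u v k l} → inS S v ≡ false → Endpoint v k l → u ≡ v → T (shares u k l)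
    ⇒shares {u} {k = k} free e refl = Equivalence.from (T-∧ {not (inS S u)})
      (Equivalence.from T-not-≡ free , Equivalence.from (T-∨ {u == k}) (Sum.map (≡⇒== ∘ sym) (≡⇒== ∘ sym) e))

  related⇒shared-free : ∀ {i j k l} → related S i j k l ≡ true →
                        ∃[ v ] inS S v ≡ false × Endpoint v i j × Endpoint v k l
  related⇒shared-free {i} {j} {k} {l} r with Equivalence.to (T-∨ {shares i k l}) (Equivalence.from T-≡ r)
  ... | inj₁ t = let free , e = shares⇒ t in i , free , inj₁ refl , e
  ... | inj₂ t = let free , e = shares⇒ t in j , free , inj₂ refl , e

  shared-free⇒related : ∀ {v i j k l} → inS S v ≡ false → Endpoint v i j → Endpoint v k l → related S i j k l ≡ true
  shared-free⇒related {i = i} {k = k} {l} free e e′ =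
    Equivalence.to T-≡ (Equivalence.from (T-∨ {shares i k l}) (Sum.map (⇒shares free e′) (⇒shares free e′) e))

  unrelated-separated : ∀ {i j k l} → related S i j k l ≡ false →
                        ∀ v → inS S v ≡ false → ¬ Endpoint v i j ⊎ ¬ Endpoint v k l
  unrelated-separated {i} {j} {k} {l} r v free with endpoint? v i j | endpoint? v k l
  ... | no  off | _       = inj₁ off
  ... | yes _   | no  off = inj₂ off
  ... | yes e   | yes e′  = contradiction (trans (sym (shared-free⇒related free e e′)) r) λ ()

Smooth : ∀ {n} → Subset n → (Fin n → ℚ) → ℚ → Set
Smooth S p τ = ∀ v → inS S v ≡ false → τ ≤ p v × τ ≤ 1ℚ - p v

smooth⇒probabilities : ∀ {n} {S : Subset n} {p τ} → 0ℚ ≤ τ → Smooth S p τ → Probabilities S p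
smooth⇒probabilities 0≤τ smooth v free =
  ℚP.≤-trans 0≤τ (proj₁ (smooth v free)) , ℚP.≤-trans 0≤τ (proj₂ (smooth v free))

coord-Ignores : ∀ {n} (g : Bool → ℚ) {i v : Fin n} → i ≢ v → Ignores (λ f → g (lookup f i)) v
coord-Ignores g i≢v f b = cong g (lookup∘update′ i≢v f b)

cut-Ignores : ∀ {n} {i j v : Fin n} → ¬ Endpoint v i j → Ignores (λ f → cut f i j) v
cut-Ignores off f b =
  cong₂ (λ x y → ind (x xor y)) (lookup∘update′ (off ∘ inj₁) f b) (lookup∘update′ (off ∘ inj₂) f b)

smooth-xor-≥ : ∀ {τ x y} → τ ≤ x → τ ≤ 1ℚ - x → 0ℚ ≤ y → y ≤ 1ℚ → τ ≤ x * (1ℚ - y) + (1ℚ - x) * y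
smooth-xor-≥ {τ} {x} {y} τ≤x τ≤1-x 0≤y y≤1 =
  ≤-from-gap _ (gap τ x y)
    (ℚP.+-mono-≤ (0≤-* (p≤q⇒0≤q-p τ≤x) (p≤q⇒0≤q-p y≤1)) (0≤-* (p≤q⇒0≤q-p τ≤1-x) 0≤y))
  where
  gap : ∀ τ x y → x * (1ℚ - y) + (1ℚ - x) * y - τ ≡ (x - τ) * (1ℚ - y) + (1ℚ - x - τ) * y
  gap = solve-∀ ℚ-ring

module Cuts {n} (S : Subset n) (h : Vec Bool n) (p : Fin n → ℚ) where

  open Moments S h p

  μ : Fin n → ℚ
  μ v = E (λ f → ind (lookup f v))

  Exp-cut : ∀ {i j} → i ≢ j → E (λ f → cut f i j) ≡ μ i * (1ℚ - μ j) + (1ℚ - μ i) * μ j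
  Exp-cut {i} {j} i≢j = begin
    E (λ f → cut f i j)
      ≡⟨ cong-≗ (λ f → ind-xor (lookup f i) (lookup f j)) ⟩
    E (λ f → ind (lookup f i) * (1ℚ - ind (lookup f j)) + (1ℚ - ind (lookup f i)) * ind (lookup f j))
      ≡⟨ +-homo _ _ ⟩
    E (λ f → ind (lookup f i) * (1ℚ - ind (lookup f j))) + E (λ f → (1ℚ - ind (lookup f i)) * ind (lookup f j))
      ≡⟨ cong₂ _+_ (Exp-*-indep S h p _ _ (separated ind (λ b → 1ℚ - ind b)))
                   (Exp-*-indep S h p _ _ (separated (λ b → 1ℚ - ind b) ind)) ⟩
    μ i * E (λ f → 1ℚ - ind (lookup f j)) + E (λ f → 1ℚ - ind (lookup f i)) * μ j
      ≡⟨ cong₂ _+_ (cong (μ i *_) (complement j)) (cong (_* μ j) (complement i)) ⟩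
    μ i * (1ℚ - μ j) + (1ℚ - μ i) * μ j
      ∎
    where
    open ≡-Reasoning
    separated : ∀ (g g′ : Bool → ℚ) v → inS S v ≡ false →
                Ignores (λ f → g (lookup f i)) v ⊎ Ignores (λ f → g′ (lookup f j)) v
    separated g g′ v _ with i Data.Fin.≟ v
    ... | no  i≢v  = inj₁ (coord-Ignores g i≢v)
    ... | yes refl = inj₂ (coord-Ignores g′ (i≢j ∘ sym))
    complement : ∀ v → E (λ f → 1ℚ - ind (lookup f v)) ≡ 1ℚ - μ v
    complement v = trans (sub-homo (λ _ → 1ℚ) _) (cong (_- μ v) (Exp-const S h p 1ℚ))

  Exp-cut-≥ : ∀ {τ} → Smooth S p τ → Probabilities S p →
              ∀ {i j} → i < j → active S i j ≡ true → τ ≤ E (λ f → cut f i j)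
  Exp-cut-≥ {τ} smooth pr {i} {j} i<j act =
    subst (τ ≤_) (sym (Exp-cut (<⇒≢ i<j))) (cut-prob-≥ (active⇒free-endpoint S i j act))
    where
    free-endpoint : ∀ u v → inS S u ≡ false → τ ≤ μ u * (1ℚ - μ v) + (1ℚ - μ u) * μ v
    free-endpoint u v free =
      let τ≤μ , τ≤1-μ = subst (λ z → τ ≤ z × τ ≤ 1ℚ - z) (sym (Exp-coord S h p u free)) (smooth u free)
          0≤μ , μ≤1   = Exp-ind-bounds S h p pr (λ f → lookup f v)
      in smooth-xor-≥ τ≤μ τ≤1-μ 0≤μ μ≤1
    swap : ∀ x y → y * (1ℚ - x) + (1ℚ - y) * x ≡ x * (1ℚ - y) + (1ℚ - x) * y
    swap = solve-∀ ℚ-ring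
    cut-prob-≥ : inS S i ≡ false ⊎ inS S j ≡ false → τ ≤ μ i * (1ℚ - μ j) + (1ℚ - μ i) * μ j
    cut-prob-≥ (inj₁ free) = free-endpoint i j free
    cut-prob-≥ (inj₂ free) = subst (τ ≤_) (swap (μ i) (μ j)) (free-endpoint j i free)

module LowerTail {n} (w : Fin n → Fin n → ℚ) (w-0≤ : ∀ i j → i < j → 0ℚ ≤ w i j)
                 (S : Subset n) (h : Vec Bool n) (p : Fin n → ℚ) where

  open Moments S h p
  open Cuts S h p

  a : Fin n → Fin n → ℚ
  a i j = ind (active S i j) * w i j

  a-0≤ : ∀ {i j} → i < j → 0ℚ ≤ a i j
  a-0≤ {i} {j} i<j = 0≤-* (ind-0≤ (active S i j)) (w-0≤ i j i<j)

  a≤w : ∀ {i j} → i < j → a i j ≤ w i j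
  a≤w {i} {j} i<j = subst (a i j ≤_) (ℚP.*-identityˡ (w i j)) (*-monoʳ-≤-0≤ (w-0≤ i j i<j) (ind-≤1 (active S i j)))

  Y-0≤ : ∀ f → 0ℚ ≤ Y w S f
  Y-0≤ f = sumPairs-0≤ λ i j i<j → 0≤-* (ind-0≤ (active S i j)) (0≤-* (w-0≤ i j i<j) (ind-0≤ (lookup f i xor lookup f j)))

  Cov-cut-≤ : Probabilities S p → ∀ i j k l → i < j → k < l →
              a i j * a k l * Cov (λ f → cut f i j) (λ f → cut f k l) ≤ ¼ * (ind (related S i j k l) * (w i j * w k l))
  Cov-cut-≤ pr i j k l i<j k<l with related S i j k l in rel
  ... | false = ℚP.≤-reflexive (begin
    a i j * a k l * Cov (λ f → cut f i j) (λ f → cut f k l)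
      ≡⟨ cong (a i j * a k l *_) (Cov-indep _ _ λ v free → Sum.map cut-Ignores cut-Ignores (unrelated-separated S rel v free)) ⟩
    a i j * a k l * 0ℚ
      ≡⟨ vanish (a i j * a k l) (w i j * w k l) ⟩
    ¼ * (0ℚ * (w i j * w k l))
      ∎)
    where
    open ≡-Reasoning
    vanish : ∀ x y → x * 0ℚ ≡ ¼ * (0ℚ * y)
    vanish = solve-∀ ℚ-ring
  ... | true = begin
    a i j * a k l * Cov (λ f → cut f i j) (λ f → cut f k l)
      ≤⟨ *-monoˡ-≤-0≤ (0≤-* (a-0≤ i<j) (a-0≤ k<l))
                      (Cov-ind-≤-¼ pr (λ f → lookup f i xor lookup f j) (λ f → lookup f k xor lookup f l)) ⟩
    a i j * a k l * ¼
      ≤⟨ *-monoʳ-≤-0≤ (ℚP.nonNegative⁻¹ ¼)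
           (ℚP.≤-trans (*-monoʳ-≤-0≤ (a-0≤ k<l) (a≤w i<j)) (*-monoˡ-≤-0≤ (w-0≤ i j i<j) (a≤w k<l))) ⟩
    w i j * w k l * ¼
      ≡⟨ reorder (w i j * w k l) ⟩
    ¼ * (1ℚ * (w i j * w k l))
      ∎
    where
    open ℚP.≤-Reasoning
    reorder : ∀ x → x * ¼ ≡ ¼ * (1ℚ * x)
    reorder = solve-∀ ℚ-ring

  Var-Y-≤ : Probabilities S p → Var (Y w S) ≤ ¼ * Uvar w S
  Var-Y-≤ pr = begin
    Var (Y w S)
      ≡⟨ Var-cong (λ f → ΣP.cong-≗ {n} λ (i , j) → sym (ℚP.*-assoc (ind (active S i j)) (w i j) (cut f i j))) ⟩
    Var (λ f → sumPairs (λ i j → a i j * cut f i j))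
      ≡⟨ Var-sumPairs a (λ i j f → cut f i j) ⟩
    sumPairs (λ i j → sumPairs (λ k l → a i j * a k l * Cov (λ f → cut f i j) (λ f → cut f k l)))
      ≤⟨ sumPairs-mono (λ i j i<j → sumPairs-mono (λ k l k<l → Cov-cut-≤ pr i j k l i<j k<l)) ⟩
    sumPairs (λ i j → sumPairs (λ k l → ¼ * (ind (related S i j k l) * (w i j * w k l))))
      ≡⟨ trans (ΣP.cong-≗ {n} λ (i , j) → ΣP.*ˡ-homo {n} ¼ _) (ΣP.*ˡ-homo {n} ¼ _) ⟩
    ¼ * Uvar w S
      ∎
    where open ℚP.≤-Reasoning

  mean-Y : E (Y w S) ≡ sumPairs (λ i j → ind (active S i j) * (w i j * E (λ f → cut f i j)))
  mean-Y = trans (sumPairs-homo {n} _) (ΣP.cong-≗ {n} λ (i , j) →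
    trans (*ˡ-homo (ind (active S i j)) (λ f → w i j * cut f i j))
          (cong (ind (active S i j) *_) (*ˡ-homo (w i j) (λ f → cut f i j))))

  Lmean-≤-mean : ∀ {τ} → Smooth S p τ → Probabilities S p → Lmean w S τ ≤ E (Y w S)
  Lmean-≤-mean {τ} smooth pr = begin
    τ * sumPairs a
      ≡⟨ ΣP.*ˡ-homo {n} τ _ ⟨
    sumPairs (λ i j → τ * a i j)
      ≤⟨ sumPairs-mono (λ i j i<j → weighted-≤ (active S i j) (w-0≤ i j i<j) (Exp-cut-≥ smooth pr i<j)) ⟩
    sumPairs (λ i j → ind (active S i j) * (w i j * E (λ f → cut f i j)))
      ≡⟨ mean-Y ⟨
    E (Y w S)
      ∎
    where
    open ℚP.≤-Reasoning
    weighted-≤ : ∀ b {w μ} → 0ℚ ≤ w → (b ≡ true → τ ≤ μ) → τ * (ind b * w) ≤ ind b * (w * μ)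
    weighted-≤ true  {w} {μ} 0≤w τ≤μ = begin
      τ * (1ℚ * w)  ≡⟨ cong (τ *_) (ℚP.*-identityˡ w) ⟩
      τ * w         ≡⟨ ℚP.*-comm τ w ⟩
      w * τ         ≤⟨ *-monoˡ-≤-0≤ 0≤w (τ≤μ refl) ⟩
      w * μ         ≡⟨ ℚP.*-identityˡ (w * μ) ⟨
      1ℚ * (w * μ)  ∎
    weighted-≤ false {w} {μ} _ _ = ℚP.≤-reflexive (vanish τ w μ)
      where
      vanish : ∀ τ w μ → τ * (0ℚ * w) ≡ 0ℚ * (w * μ)
      vanish = solve-∀ ℚ-ring

  lower-tail : ∀ {τ δ ε} → 0ℚ ≤ τ → 0ℚ ℚ.< δ → 0ℚ ℚ.< ε → Smooth S p τ →
               Uvar w S ≤ δ * (ε * ε) * (Lmean w S τ * Lmean w S τ) →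
               Pr S h p (λ f → Y w S f <ᵇ ((1ℚ - ε) * E (Y w S))) ℚ.< δ
  lower-tail {τ} {δ} {ε} 0≤τ 0<δ 0<ε smooth small = by-sign (0ℚ ℚP.<? M)
    where
    open ℚP.≤-Reasoning
    pr : Probabilities S p
    pr = smooth⇒probabilities {S = S} 0≤τ smooth
    M L K tail : ℚ
    M = E (Y w S)
    L = Lmean w S τ
    K = (ε * M) * (ε * M)
    tail = Pr S h p (λ f → Y w S f <ᵇ ((1ℚ - ε) * M))
    0≤M : 0ℚ ≤ M
    0≤M = subst (_≤ M) (Exp-const S h p 0ℚ) (Exp-mono S h p pr Y-0≤)
    0≤δε² : 0ℚ ≤ δ * (ε * ε)
    0≤δε² = 0≤-* (ℚP.<⇒≤ 0<δ) (0≤p*p ε)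
    regroup : ∀ δ ε m → ¼ * (δ * (ε * ε) * (m * m)) ≡ ¼ * δ * ((ε * m) * (ε * m))
    regroup = solve-∀ ℚ-ring
    tail*K≤ : tail * K ≤ ¼ * δ * K
    tail*K≤ = begin
      tail * K                     ≡⟨ ℚP.*-comm tail K ⟩
      K * tail                     ≤⟨ Chebyshev-lower pr (Y w S) ε (ℚP.<⇒≤ 0<ε) 0≤M ⟩
      Var (Y w S)                  ≤⟨ Var-Y-≤ pr ⟩
      ¼ * Uvar w S                 ≤⟨ *-monoˡ-≤-0≤ (ℚP.nonNegative⁻¹ ¼) small ⟩
      ¼ * (δ * (ε * ε) * (L * L))  ≤⟨ *-monoˡ-≤-0≤ (ℚP.nonNegative⁻¹ ¼) (*-monoˡ-≤-0≤ 0≤δε²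
                                        (square-mono-≤ (0≤-* 0≤τ (sumPairs-0≤ λ _ _ → a-0≤)) (Lmean-≤-mean smooth pr))) ⟩
      ¼ * (δ * (ε * ε) * (M * M))  ≡⟨ regroup δ ε M ⟩
      ¼ * δ * K                    ∎
    ¼δ<δ : ¼ * δ ℚ.< δ
    ¼δ<δ = subst (¼ * δ ℚ.<_) (ℚP.*-identityˡ δ) (ℚP.*-monoˡ-<-pos δ {{ℚ.positive 0<δ}} (toWitness {a? = ¼ ℚP.<? 1ℚ} _))
    tail-empty : M ≡ 0ℚ → tail ≡ 0ℚ
    tail-empty M≡0 = trans (cong-≗ λ f → cong ind (dec-false (Y w S f ℚP.<? (1ℚ - ε) * M) (below-0 f))) (Exp-const S h p 0ℚ)
      where
      below-0 : ∀ f → ¬ (Y w S f ℚ.< (1ℚ - ε) * M)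
      below-0 f lt = ℚP.<-irrefl refl (ℚP.≤-<-trans (Y-0≤ f)
                       (subst (Y w S f ℚ.<_) (trans (cong ((1ℚ - ε) *_) M≡0) (ℚP.*-zeroʳ (1ℚ - ε))) lt))
    by-sign : Dec (0ℚ ℚ.< M) → tail ℚ.< δ
    by-sign (yes 0<M) = ℚP.≤-<-trans (ℚP.*-cancelʳ-≤-pos K {{ℚ.positive 0<K}} tail*K≤) ¼δ<δ
      where
      0<εM : 0ℚ ℚ.< ε * M
      0<εM = ℚP.positive⁻¹ _ {{ℚP.pos*pos⇒pos ε {{ℚ.positive 0<ε}} M {{ℚ.positive 0<M}}}}
      0<K : 0ℚ ℚ.< K
      0<K = ℚP.positive⁻¹ _ {{ℚP.pos*pos⇒pos (ε * M) {{ℚ.positive 0<εM}} (ε * M) {{ℚ.positive 0<εM}}}}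
    by-sign (no ¬0<M) = subst (ℚ._< δ) (sym (tail-empty (ℚP.≤-antisym (ℚP.≮⇒≥ ¬0<M) 0≤M))) 0<δ

module HeavyVertex {n} (w : Fin n → Fin n → ℚ) (w-0≤ : ∀ i j → i < j → 0ℚ ≤ w i j) (S : Subset n) where

  weight-at : Fin n → Fin n → Fin n → ℚ
  weight-at v i j = ind (active S i j ∧ (i == v ∨ j == v)) * w i j

  free-ind : Fin n → ℚ
  free-ind v = ind (not (inS S v))

  weight-at-0≤ : ∀ v {i j} → i < j → 0ℚ ≤ weight-at v i j
  weight-at-0≤ v {i} {j} i<j = 0≤-* (ind-0≤ (active S i j ∧ (i == v ∨ j == v))) (w-0≤ i j i<j)

  actdeg-0≤ : ∀ v → 0ℚ ≤ actdeg w S v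
  actdeg-0≤ v = sumPairs-0≤ λ _ _ → weight-at-0≤ v

  shared-weight : Fin n → Fin n → Fin n → Fin n → Fin n → ℚ
  shared-weight v i j k l = free-ind v * (weight-at v i j * weight-at v k l)

  shared-weight-0≤ : ∀ {i j k l} → i < j → k < l → ∀ v → 0ℚ ≤ shared-weight v i j k l
  shared-weight-0≤ i<j k<l v = 0≤-* (ind-0≤ (not (inS S v))) (0≤-* (weight-at-0≤ v i<j) (weight-at-0≤ v k<l))

  related-≤-shared : ∀ i j k l → i < j → k < l →
                     ind (related S i j k l) * (w i j * w k l) ≤ sumFin (λ v → shared-weight v i j k l)
  related-≤-shared i j k l i<j k<l with related S i j k l in rel
  ... | false = subst (_≤ sumFin (λ v → shared-weight v i j k l)) (sym (ℚP.*-zeroˡ (w i j * w k l)))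
                      (sumFin-0≤ (shared-weight-0≤ i<j k<l))
  ... | true with related⇒shared-free S rel
  ...   | v , free-v , e , e′ =
    subst (_≤ sumFin (λ v → shared-weight v i j k l)) (hit free-v e e′) (term≤sumFin (shared-weight-0≤ i<j k<l) v)
    where
    hit : inS S v ≡ false → Endpoint v i j → Endpoint v k l → shared-weight v i j k l ≡ 1ℚ * (w i j * w k l)
    hit free-v e e′
      rewrite free-v | free-endpoint⇒incident S free-v e | free-endpoint⇒incident S free-v e′ = unit (w i j) (w k l)
      where
      unit : ∀ x y → 1ℚ * (1ℚ * x * (1ℚ * y)) ≡ 1ℚ * (x * y)
      unit = solve-∀ ℚ-ring

  Uvar-≤-free-square-sum : Uvar w S ≤ sumFin (λ v → free-ind v * (actdeg w S v * actdeg w S v))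
  Uvar-≤-free-square-sum = begin
    Uvar w S
      ≤⟨ sumPairs-mono (λ i j i<j → sumPairs-mono (λ k l k<l → related-≤-shared i j k l i<j k<l)) ⟩
    sumPairs (λ i j → sumPairs (λ k l → sumFin (λ v → shared-weight v i j k l)))
      ≡⟨ trans (ΣF.sumPairs-homo {n} (λ i j v → sumPairs (λ k l → shared-weight v i j k l)))
              (ΣP.cong-≗ {n} λ (i , j) → ΣF.sumPairs-homo {n} (λ k l v → shared-weight v i j k l)) ⟨
    sumFin (λ v → sumPairs (λ i j → sumPairs (λ k l → shared-weight v i j k l)))
      ≡⟨ ΣF.cong-≗ {n} (λ v → trans (ΣP.cong-≗ {n} (λ (i , j) → ΣP.*ˡ-homo {n} (free-ind v) _)) (ΣP.*ˡ-homo {n} (free-ind v) _)) ⟩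
    sumFin (λ v → free-ind v * sumPairs (λ i j → sumPairs (λ k l → weight-at v i j * weight-at v k l)))
      ≡⟨ ΣF.cong-≗ {n} (λ v → cong (free-ind v *_) (sumPairs-* (weight-at v) (weight-at v))) ⟨
    sumFin (λ v → free-ind v * (actdeg w S v * actdeg w S v))
      ∎
    where open ℚP.≤-Reasoning

  free-square-sum-≤ : ∀ m → (∀ v → inS S v ≡ false → actdeg w S v ≤ actdeg w S m) →
                      sumFin (λ v → free-ind v * (actdeg w S v * actdeg w S v)) ≤ actdegTot w S * actdeg w S m
  free-square-sum-≤ m max = ℚP.≤-trans (sumFin-mono termwise) (ℚP.≤-reflexive (ΣF.*ʳ-homo {n} (actdeg w S m) _))
    where
    termwise : ∀ v → free-ind v * (actdeg w S v * actdeg w S v) ≤ free-ind v * actdeg w S v * actdeg w S m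
    termwise v with inS S v in eq
    ... | true  = ℚP.≤-reflexive (vanish (actdeg w S v) (actdeg w S m))
      where
      vanish : ∀ x y → 0ℚ * (x * x) ≡ 0ℚ * x * y
      vanish = solve-∀ ℚ-ring
    ... | false = subst₂ _≤_ (unit₁ (actdeg w S v)) (unit₂ (actdeg w S v) (actdeg w S m))
                         (*-monoˡ-≤-0≤ (actdeg-0≤ v) (max v eq))
      where
      unit₁ : ∀ x → x * x ≡ 1ℚ * (x * x)
      unit₁ = solve-∀ ℚ-ring
      unit₂ : ∀ x y → x * y ≡ 1ℚ * x * y
      unit₂ = solve-∀ ℚ-ring

  activeWeight : ℚ
  activeWeight = sumPairs (λ i j → ind (active S i j) * w i j)

  actdegTot-≤ : actdegTot w S ≤ activeWeight + activeWeight
  actdegTot-≤ = begin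
    sumFin (λ v → free-ind v * actdeg w S v)
      ≡⟨ ΣF.cong-≗ {n} (λ v → ΣP.*ˡ-homo {n} (free-ind v) _) ⟨
    sumFin (λ v → sumPairs (λ i j → free-ind v * weight-at v i j))
      ≡⟨ ΣF.sumPairs-homo {n} (λ i j v → free-ind v * weight-at v i j) ⟩
    sumPairs (λ i j → sumFin (λ v → free-ind v * weight-at v i j))
      ≤⟨ sumPairs-mono (λ i j i<j → sumFin-mono (incidence-≤ i<j)) ⟩
    sumPairs (λ i j → sumFin (λ v → ind (active S i j) * w i j * (ind (i == v) + ind (j == v))))
      ≡⟨ ΣP.cong-≗ {n} (λ (i , j) → two-endpoints (ind (active S i j) * w i j) i j) ⟩
    sumPairs (λ i j → ind (active S i j) * w i j + ind (active S i j) * w i j)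
      ≡⟨ ΣP.+-homo {n} _ _ ⟩
    _ ∎
    where
    open ℚP.≤-Reasoning
    incidence-≤ : ∀ {i j} → i < j → ∀ v →
                  free-ind v * weight-at v i j ≤ ind (active S i j) * w i j * (ind (i == v) + ind (j == v))
    incidence-≤ {i} {j} i<j v = begin
      free-ind v * weight-at v i j
        ≤⟨ ind-*-≤ (not (inS S v)) (weight-at-0≤ v i<j) ⟩
      ind (active S i j ∧ (i == v ∨ j == v)) * w i j
        ≤⟨ *-monoʳ-≤-0≤ (w-0≤ i j i<j) (ind-∧∨-≤ (active S i j) (i == v) (j == v)) ⟩
      ind (active S i j) * (ind (i == v) + ind (j == v)) * w i j
        ≡⟨ reorder (ind (active S i j)) _ (w i j) ⟩
      ind (active S i j) * w i j * (ind (i == v) + ind (j == v))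
        ∎
      where
      reorder : ∀ a e w → a * e * w ≡ a * w * e
      reorder = solve-∀ ℚ-ring
    two-endpoints : ∀ c i j → sumFin (λ v → c * (ind (i == v) + ind (j == v))) ≡ c + c
    two-endpoints c i j = begin-equality
      sumFin (λ v → c * (ind (i == v) + ind (j == v)))              ≡⟨ ΣF.*ˡ-homo {n} c _ ⟩
      c * sumFin (λ v → ind (i == v) + ind (j == v))                ≡⟨ cong (c *_) (ΣF.+-homo {n} _ _) ⟩
      c * (sumFin (λ v → ind (i == v)) + sumFin (λ v → ind (j == v))) ≡⟨ cong (c *_) (cong₂ _+_ (sumFin-δ i) (sumFin-δ j)) ⟩
      c * (1ℚ + 1ℚ)                                                 ≡⟨ double c ⟩
      c + c                                                         ∎
      where
      double : ∀ c → c * (1ℚ + 1ℚ) ≡ c + c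
      double = solve-∀ ℚ-ring

  maximum-is-heavy : ∀ {τ δ ε} m → 0ℚ ≤ δ → (∀ v → inS S v ≡ false → actdeg w S v ≤ actdeg w S m) →
                     δ * (ε * ε) * (Lmean w S τ * Lmean w S τ) ≤ Uvar w S →
                     ¼ * (τ * τ) * (ε * ε) * δ * actdegTot w S ≤ actdeg w S m
  maximum-is-heavy {τ} {δ} {ε} m 0≤δ max large = by-sign (0ℚ ℚP.<? D)
    where
    open ℚP.≤-Reasoning
    D A K : ℚ
    D = actdegTot w S
    A = activeWeight
    K = ¼ * (τ * τ) * (ε * ε) * δ
    0≤K : 0ℚ ≤ K
    0≤K = 0≤-* (0≤-* (0≤-* (ℚP.nonNegative⁻¹ ¼) (0≤p*p τ)) (0≤p*p ε)) 0≤δ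
    0≤D : 0ℚ ≤ D
    0≤D = sumFin-0≤ λ v → 0≤-* (ind-0≤ (not (inS S v))) (actdeg-0≤ v)
    commute : ∀ k t → t * (k * t) ≡ k * (t * t)
    commute = solve-∀ ℚ-ring
    unfold : ∀ τ ε δ a → ¼ * (τ * τ) * (ε * ε) * δ * ((a + a) * (a + a)) ≡ δ * (ε * ε) * ((τ * a) * (τ * a))
    unfold = solve-∀ ℚ-ring
    D*KD≤ : D * (K * D) ≤ D * actdeg w S m
    D*KD≤ = begin
      D * (K * D)                                            ≡⟨ commute K D ⟩
      K * (D * D)                                            ≤⟨ *-monoˡ-≤-0≤ 0≤K (square-mono-≤ 0≤D actdegTot-≤) ⟩
      K * ((A + A) * (A + A))                                ≡⟨ unfold τ ε δ A ⟩
      δ * (ε * ε) * (Lmean w S τ * Lmean w S τ)              ≤⟨ large ⟩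
      Uvar w S                                               ≤⟨ Uvar-≤-free-square-sum ⟩
      sumFin (λ v → free-ind v * (actdeg w S v * actdeg w S v))  ≤⟨ free-square-sum-≤ m max ⟩
      D * actdeg w S m                                       ∎
    by-sign : Dec (0ℚ ℚ.< D) → K * D ≤ actdeg w S m
    by-sign (yes 0<D) = ℚP.*-cancelˡ-≤-pos D {{ℚ.positive 0<D}} D*KD≤
    by-sign (no ¬0<D) = subst (_≤ actdeg w S m) (sym (trans (cong (K *_) D≡0) (ℚP.*-zeroʳ K))) (actdeg-0≤ m)
      where
      D≡0 : D ≡ 0ℚ
      D≡0 = ℚP.≤-antisym (ℚP.≮⇒≥ ¬0<D) 0≤D

  heavy-vertex : ∀ {τ δ ε} → 0ℚ ≤ δ → ∃[ v ] inS S v ≡ false →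
                 δ * (ε * ε) * (Lmean w S τ * Lmean w S τ) ≤ Uvar w S →
                 ∃[ m ] inS S m ≡ false × (¼ * (τ * τ) * (ε * ε) * δ * actdegTot w S ≤ actdeg w S m)
  heavy-vertex {τ} {δ} {ε} 0≤δ (v₀ , free₀) large =
    let m , free-m , max = finite-argmax (actdeg w S) (λ v → inS S v Data.Bool.≟ false) free₀
    in m , free-m , maximum-is-heavy {τ} {δ} {ε} m 0≤δ max large

lemma1 : (n : ℕ) (w : Fin n → Fin n → ℚ)
  → (∀ i j → i Data.Fin.< j → (0ℚ ≤ w i j) × (w i j ≤ 1ℚ))
  → sumPairs w ≡ 1ℚ
  → (S : Subset n) → (∃[ v ] v ∉ S)
  → (h : Vec Bool n)
  → (τ δ₀ ε₀ : ℚ) → 0ℚ Data.Rational.< τ → 0ℚ Data.Rational.< δ₀ → 0ℚ Data.Rational.< ε₀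
  → (p : Fin n → ℚ)
  → (∀ v → v ∉ S → (τ ≤ p v) × (τ ≤ 1ℚ - p v))
  → ((Uvar w S ≤ δ₀ * (ε₀ * ε₀) * (Lmean w S τ * Lmean w S τ)
       → Pr S h p (λ f → Y w S f <ᵇ ((1ℚ - ε₀) * Exp S h p (Y w S)))
           Data.Rational.< δ₀)
    × (δ₀ * (ε₀ * ε₀) * (Lmean w S τ * Lmean w S τ) ≤ Uvar w S
       → ∃[ v ] (v ∉ S × ((+ 1 / 4) * (τ * τ) * (ε₀ * ε₀) * δ₀ * actdegTot w S ≤ actdeg w S v))))
-- Both conclusions are invariant under scaling w.
lemma1 n w w-bounds _ S (v₀ , v₀∉S) h τ δ₀ ε₀ 0<τ 0<δ₀ 0<ε₀ p smooth-∉ =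
  LowerTail.lower-tail w w-0≤ S h p (ℚP.<⇒≤ 0<τ) 0<δ₀ 0<ε₀ smooth ,
  λ large →
    let m , free-m , heavy = HeavyVertex.heavy-vertex w w-0≤ S {τ} {δ₀} {ε₀} (ℚP.<⇒≤ 0<δ₀) (v₀ , ∉⇒free v₀∉S) large
    in m , free⇒∉ free-m , heavy
  where
  w-0≤ : ∀ i j → i < j → 0ℚ ≤ w i j
  w-0≤ i j i<j = proj₁ (w-bounds i j i<j)
  smooth : Smooth S p τ
  smooth v free = smooth-∉ v (free⇒∉ free)
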